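{- $\operatorname{achr}(K_6\square K_4)\ge 12$, $\operatorname{achr}(K_6\square K_6)\ge 18$ and $\operatorname{achr}(K_6\square K_8)\ge 21$.
   Context: For a finite simple graph $G$ and a finite set of colours $C$, a vertex colouring $f:V(G)\to C$ is complete if for every pair of distinct colours $c_1,c_2\in C$ there is an edge $v_1v_2$ of $G$ with $f(v_i)=c_i$, $i=1,2$. The achromatic number $\operatorname{achr}(G)$ is the maximum number of colours in a proper complete vertex colouring of $G$. $K_p\square K_q$ denotes the Cartesian product of complete graphs: vertex set $[1,p]\times[1,q]$, with $(i_1,j_1)$ adjacent to $(i_2,j_2)$ iff either $i_1=i_2$ and $j_1\ne j_2$, or $i_1\ne i_2$ and $j_1=j_2$. -}

module Defs where

open import Data.Nat using (ℕ)
open import Data.Fin using (Fin)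
open import Data.Product using (_×_; _,_; ∃; ∃-syntax)
open import Data.Sum using (_⊎_)
open import Relation.Binary.PropositionalEquality using (_≡_; _≢_)
open import Relation.Nullary using (¬_)

record Graph : Set₁ where
  field
    V   : Set
    Adj : V → V → Set
open Graph public

KK : ℕ → ℕ → Graph
KK p q = record
  { V   = Fin p × Fin q
  ; Adj = λ { (i₁ , j₁) (i₂ , j₂) →
              (i₁ ≡ i₂ × j₁ ≢ j₂) ⊎ (i₁ ≢ i₂ × j₁ ≡ j₂) } }

Proper : (G : Graph) {C : Set} → (V G → C) → Set
Proper G f = ∀ u v → Adj G u v → f u ≢ f v

Complete : (G : Graph) {C : Set} → (V G → C) → Set
Complete G {C} f = ∀ (c₁ c₂ : C) → c₁ ≢ c₂ →
  ∃[ v₁ ] ∃[ v₂ ] (Adj G v₁ v₂ × f v₁ ≡ c₁ × f v₂ ≡ c₂)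

-- achr(G) ≥ k : there is a proper complete colouring using a colour set
-- of exactly k colours (Fin k). Since achr is the maximum such number,
-- this is exactly the statement achr(G) ≥ k.
AchrAtLeast : Graph → ℕ → Set
AchrAtLeast G k = ∃[ f ] (Proper G {Fin k} f × Complete G f)

-- Each bound is witnessed by an explicit colouring of the grid, given as a
-- table of colours indexed by rows and columns. Being proper and complete
-- are finite properties of a colouring of K_p □ K_q, so both are decided
-- by exhaustive search and the tables are certified by evaluation.
module Submission where

open import Defs
open import Data.Nat using (ℕ)
open import Data.Fin using (Fin; #_)
open import Data.Fin.Properties using (all?; any?; _≟_)
open import Data.Vec using (Vec; _∷_; []; lookup)
open import Data.Product using (_×_; _,_; ∃; ∃-syntax)
open import Level using (Level)
open import Relation.Nullary using (Dec; ¬?)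
open import Relation.Nullary.Decidable
  using (True; toWitness; map′; _×-dec_; _⊎-dec_; _→-dec_)
open import Relation.Unary using (Pred; Decidable)
open import Relation.Binary.PropositionalEquality using (_≡_; _≢_)

private
  variable
    ℓ : Level
    p q k : ℕ

all-pair? : {P : Pred (Fin p × Fin q) ℓ} → Decidable P → Dec (∀ u → P u)
all-pair? P? = map′ (λ all (i , j) → all i j) (λ all i j → all (i , j))
  (all? λ i → all? λ j → P? (i , j))

any-pair? : {P : Pred (Fin p × Fin q) ℓ} → Decidable P → Dec (∃ P)
any-pair? P? = map′ (λ (i , j , Pij) → (i , j) , Pij) (λ ((i , j) , Pij) → i , j , Pij)
  (any? λ i → any? λ j → P? (i , j))

adjacent? : (u v : Fin p × Fin q) → Dec (Adj (KK p q) u v)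
adjacent? (i₁ , j₁) (i₂ , j₂) =
  ((i₁ ≟ i₂) ×-dec ¬? (j₁ ≟ j₂)) ⊎-dec (¬? (i₁ ≟ i₂) ×-dec (j₁ ≟ j₂))

module _ (f : Fin p × Fin q → Fin k) where

  proper? : Dec (Proper (KK p q) f)
  proper? = all-pair? λ u → all-pair? λ v →
    adjacent? u v →-dec ¬? (f u ≟ f v)

  -- Completeness with the quantifiers reordered so that the search fixes a
  -- vertex of colour c₁ before looking at its neighbours.
  ColourMeets : Fin k → Fin k → Set
  ColourMeets c₁ c₂ =
    ∃[ v₁ ] (f v₁ ≡ c₁ × ∃[ v₂ ] (f v₂ ≡ c₂ × Adj (KK p q) v₁ v₂))

  colourMeets? : ∀ c₁ c₂ → Dec (ColourMeets c₁ c₂)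
  colourMeets? c₁ c₂ = any-pair? λ v₁ → (f v₁ ≟ c₁) ×-dec
    any-pair? λ v₂ → (f v₂ ≟ c₂) ×-dec adjacent? v₁ v₂

  meets⇒complete : (∀ c₁ c₂ → c₁ ≢ c₂ → ColourMeets c₁ c₂) → Complete (KK p q) f
  meets⇒complete meets c₁ c₂ c₁≢c₂ with meets c₁ c₂ c₁≢c₂
  ... | v₁ , fv₁ , v₂ , fv₂ , adj = v₁ , v₂ , adj , fv₁ , fv₂

  complete⇒meets : Complete (KK p q) f → ∀ c₁ c₂ → c₁ ≢ c₂ → ColourMeets c₁ c₂
  complete⇒meets complete c₁ c₂ c₁≢c₂ with complete c₁ c₂ c₁≢c₂
  ... | v₁ , v₂ , adj , fv₁ , fv₂ = v₁ , fv₁ , v₂ , fv₂ , adj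

  complete? : Dec (Complete (KK p q) f)
  complete? = map′ meets⇒complete complete⇒meets
    (all? λ c₁ → all? λ c₂ → ¬? (c₁ ≟ c₂) →-dec colourMeets? c₁ c₂)

achrAtLeast : (f : Fin p × Fin q → Fin k) →
              {True (proper? f)} → {True (complete? f)} → AchrAtLeast (KK p q) k
achrAtLeast f {isProper} {isComplete} =
  f , toWitness isProper , toWitness isComplete

tableColouring : Vec (Vec (Fin k) q) p → Fin p × Fin q → Fin k
tableColouring rows (i , j) = lookup (lookup rows i) j

colouring₆₄ : Vec (Vec (Fin 12) 4) 6
colouring₆₄ =
  (# 7 ∷  # 0 ∷ # 10 ∷  # 9 ∷ []) ∷
  (# 3 ∷  # 8 ∷  # 5 ∷ # 11 ∷ []) ∷
  (# 1 ∷ # 10 ∷ # 11 ∷  # 4 ∷ []) ∷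
  (# 4 ∷  # 3 ∷  # 0 ∷  # 6 ∷ []) ∷
  (# 2 ∷  # 1 ∷  # 6 ∷  # 8 ∷ []) ∷
  (# 5 ∷  # 9 ∷  # 2 ∷  # 7 ∷ []) ∷ []

colouring₆₆ : Vec (Vec (Fin 18) 6) 6
colouring₆₆ =
  ( # 2 ∷ # 13 ∷  # 9 ∷ # 14 ∷  # 7 ∷  # 3 ∷ []) ∷
  ( # 7 ∷  # 6 ∷ # 12 ∷ # 11 ∷  # 2 ∷ # 17 ∷ []) ∷
  ( # 0 ∷ # 16 ∷ # 15 ∷  # 3 ∷  # 5 ∷ # 14 ∷ []) ∷
  ( # 8 ∷  # 9 ∷ # 13 ∷  # 4 ∷  # 1 ∷ # 10 ∷ []) ∷
  (# 15 ∷ # 17 ∷  # 0 ∷  # 1 ∷  # 4 ∷  # 6 ∷ []) ∷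
  (# 10 ∷  # 5 ∷ # 11 ∷ # 12 ∷ # 16 ∷  # 8 ∷ []) ∷ []

colouring₆₈ : Vec (Vec (Fin 21) 8) 6
colouring₆₈ =
  (# 19 ∷ # 11 ∷ # 13 ∷ # 14 ∷ # 10 ∷ # 16 ∷  # 4 ∷ # 20 ∷ []) ∷
  ( # 1 ∷ # 17 ∷  # 7 ∷ # 15 ∷  # 9 ∷  # 5 ∷  # 2 ∷ # 19 ∷ []) ∷
  ( # 0 ∷  # 3 ∷ # 16 ∷  # 2 ∷  # 1 ∷ # 13 ∷  # 9 ∷ # 18 ∷ []) ∷
  (# 12 ∷ # 18 ∷ # 15 ∷  # 7 ∷  # 4 ∷ # 10 ∷ # 20 ∷  # 3 ∷ []) ∷
  ( # 4 ∷  # 5 ∷  # 6 ∷  # 0 ∷ # 20 ∷ # 17 ∷ # 10 ∷  # 8 ∷ []) ∷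
  ( # 9 ∷ # 14 ∷  # 8 ∷ # 11 ∷  # 2 ∷ # 12 ∷  # 1 ∷  # 6 ∷ []) ∷ []

proposition4 : AchrAtLeast (KK 6 4) 12 × AchrAtLeast (KK 6 6) 18 × AchrAtLeast (KK 6 8) 21
proposition4 =
  achrAtLeast (tableColouring colouring₆₄) ,
  achrAtLeast (tableColouring colouring₆₆) ,
  achrAtLeast (tableColouring colouring₆₈)
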